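{- For $n\ge1$, $$\sum_{\sigma\in\mathfrak S_{n}}u^{{\rm L}(\sigma)}(-1)^{{\rm RLmin}(\sigma)}=\begin{cases}(1-u)^{\lfloor n/2\rfloor},& n\text{ even},\\ -(1-u)^{\lfloor n/2\rfloor},& n\text{ odd}.\end{cases}$$
   Context: $\mathfrak S_n$ is the set of permutations $\sigma=\sigma_1\cdots\sigma_n$ of $[n]$. ${\rm L}(\sigma)$ is the number of left peaks: $i$ with $1\le i<n$ and $\sigma_{i-1}<\sigma_i>\sigma_{i+1}$, with the convention $\sigma_0=0$. ${\rm RLmin}(\sigma)$ is the number of entries $\sigma_i$ smaller than all entries to their right. -}

module Defs where

open import Level using (Level)
open import Data.Nat using (ℕ; zero; suc; _<ᵇ_) renaming (_+_ to _+ℕ_)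
open import Data.Bool using (Bool; true; false; _∧_; if_then_else_)
open import Data.List using (List; []; _∷_; map; upTo; concatMap; filter; foldr)
import Data.Nat.Properties as ℕₚ
open import Data.List.Relation.Unary.Unique.DecPropositional ℕₚ._≟_ using (unique?)
open import Algebra.Bundles using (CommutativeRing; Semiring)
import Algebra.Definitions.RawSemiring as RS

words : ℕ → ℕ → List (List ℕ)
words n zero    = [] ∷ []
words n (suc k) = concatMap (λ w → map (λ a → a ∷ w) (map suc (upTo n))) (words n k)

-- 𝔖ₙ: all permutations of [n] in one-line notation, i.e. the words of
-- length n over [n] whose entries are pairwise distinct.
perms : ℕ → List (List ℕ)
perms n = filter unique? (words n n)

-- Left peaks: positions i with 1 ≤ i < n and σ_{i-1} < σ_i > σ_{i+1},
-- where σ₀ = 0.  Computed on 0 ∷ σ by scanning consecutive triples.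
peaks : List ℕ → ℕ
peaks (a ∷ b ∷ c ∷ rest) = (if (a <ᵇ b) ∧ (c <ᵇ b) then 1 else 0) +ℕ peaks (b ∷ c ∷ rest)
peaks _ = 0

L : List ℕ → ℕ
L σ = peaks (0 ∷ σ)

allGreater : ℕ → List ℕ → Bool
allGreater x []       = true
allGreater x (y ∷ ys) = (x <ᵇ y) ∧ allGreater x ys

RLmin : List ℕ → ℕ
RLmin []       = 0
RLmin (x ∷ xs) = (if allGreater x xs then 1 else 0) +ℕ RLmin xs

module _ {c ℓ : Level} (R : CommutativeRing c ℓ) where
  open CommutativeRing R using (Carrier; _+_; _*_; -_; 0#; 1#; semiring)
  open RS (Semiring.rawSemiring semiring) using (_^_)

  sumLR : Carrier → ℕ → Carrier
  sumLR u n = foldr (λ σ acc → ((u ^ L σ) * ((- 1#) ^ RLmin σ)) + acc) 0# (perms n)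

open import Relation.Binary.PropositionalEquality using (_≡_; refl)
open import Data.List using (length)
_ : length (perms 3) ≡ 6
_ = refl
_ : L (2 ∷ 3 ∷ 1 ∷ []) ≡ 1
_ = refl
_ : L (3 ∷ 1 ∷ 2 ∷ []) ≡ 1
_ = refl
_ : L (1 ∷ 2 ∷ 3 ∷ []) ≡ 0
_ = refl
_ : RLmin (2 ∷ 3 ∷ 1 ∷ []) ≡ 1
_ = refl
_ : RLmin (1 ∷ 3 ∷ 2 ∷ []) ≡ 2
_ = refl

{-# OPTIONS --safe #-}

-- Write Sₙ for the sum. Exchanging the values 1 and 2 leaves L unchanged unless σ begins with 1 2 or 2 1,
-- and it lowers RLmin by one when 1 precedes 2: 1 is always a right-to-left minimum, 2 is one exactly when
-- it comes after 1. So the permutations of [n + 2] not beginning with {1, 2} cancel in pairs. The others are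
-- 1 2 τ and 2 1 τ with τ a permutation of {3, …, n + 2}, of weights w(τ) and −u w(τ); hence
-- S_{n+2} = (1 − u) Sₙ, and S₀ = 1, S₁ = −1 give the formula.
-- Sums over permutations are taken over all words of length n over [n], with weight 0 on words with a
-- repeated letter, so that exchanging 1 and 2 and shifting letters by 2 become reindexings of words.
module Submission where

open import Defs
open import Level using (Level)
open import Function using (_∘_; Equivalence; mk⇔)
open import Data.Bool using (Bool; true; false; _∧_; not; if_then_else_)
open import Data.Bool.Properties using (T-≡; ∧-identityʳ; ∧-zeroʳ; not-involutive; if-eta)
open import Data.Nat using (ℕ; zero; suc; _<_; _≤_; _≥_; _<?_; z≤n; s≤s; _%_; ⌊_/2⌋)
open import Data.Nat.Properties using (+-suc; suc-injective; <⇒≢; <⇒≤; ≤⇒≯; ≤-trans; ≤-reflexive)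
open import Data.Product using (_×_; _,_)
open import Data.Sum using (inj₁; inj₂)
open import Data.List using (List; []; _∷_; _++_; map; concat; filter; foldr; length; upTo)
open import Data.List.Properties using (map-applyUpTo; map-upTo; length-++; length-map; length-upTo)
open import Data.List.Relation.Unary.All as All using (All; []; _∷_; all?)
open import Data.List.Relation.Unary.All.Properties using (All¬⇒¬Any; concat⁺; map⁺)
open import Data.List.Relation.Unary.Any using (here; there)
open import Data.List.Relation.Unary.AllPairs using ([]; _∷_)
open import Data.List.Relation.Unary.Unique.Propositional using (Unique)
import Data.List.Relation.Unary.Unique.Propositional.Properties as Unique
open import Data.List.Relation.Unary.Unique.DecPropositional Data.Nat._≟_ using (unique?)
open import Data.List.Membership.Propositional using (_∈_; _∉_)
open import Data.List.Membership.Propositional.Properties using (∈-∃++; ∈-++⁻; ∈-++⁺ˡ; ∈-++⁺ʳ; ∈-map⁺; ∈-map⁻)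
open import Data.List.Relation.Binary.Subset.Propositional using (_⊆_)
open import Relation.Binary.Definitions using (DecidableEquality)
open import Relation.Binary.PropositionalEquality using (_≡_; _≢_; refl; sym; trans; cong; cong₂; module ≡-Reasoning)
open import Relation.Nullary using (¬_; Dec; yes; no; does; contradiction)
open import Relation.Nullary.Decidable using (dec-true; dec-false; does-⇔)
open import Relation.Unary using (Decidable)
open import Relation.Unary.Properties using (U?; U-Universal)
open import Algebra.Bundles using (CommutativeMonoid; CommutativeRing; Semiring)
import Algebra.Definitions.RawSemiring as RawSemiringDefs

does≡true⇒ : ∀ {p} {P : Set p} (P? : Dec P) → does P? ≡ true → P
does≡true⇒ (yes p) _ = p

module _ {a} {A : Set a} where

  private
    length-++-∷ : ∀ (us : List A) {x} vs → length (us ++ x ∷ vs) ≡ suc (length (us ++ vs))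
    length-++-∷ us {x} vs =
      trans (length-++ us) (trans (+-suc (length us) (length vs)) (cong suc (sym (length-++ us))))

    ⊆-delete : ∀ {xs us vs : List A} {x} → xs ⊆ us ++ x ∷ vs → x ∉ xs → xs ⊆ us ++ vs
    ⊆-delete {us = us} xs⊆ x∉xs y∈xs with ∈-++⁻ us (xs⊆ y∈xs)
    ... | inj₁ y∈us          = ∈-++⁺ˡ y∈us
    ... | inj₂ (here refl)   = contradiction y∈xs x∉xs
    ... | inj₂ (there y∈vs)  = ∈-++⁺ʳ us y∈vs

  unique-⊆⇒length≤ : ∀ {xs ys : List A} → Unique xs → xs ⊆ ys → length xs ≤ length ys
  unique-⊆⇒length≤ [] _ = z≤n
  unique-⊆⇒length≤ {x ∷ xs} (x∉xs ∷ u) x∷xs⊆ys with ∈-∃++ (x∷xs⊆ys (here refl))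
  ... | us , vs , refl =
    ≤-trans (s≤s (unique-⊆⇒length≤ u (⊆-delete (λ p → x∷xs⊆ys (there p)) (All¬⇒¬Any x∉xs))))
            (≤-reflexive (sym (length-++-∷ us vs)))

  module _ (_≟_ : DecidableEquality A) where
    open import Data.List.Membership.DecPropositional _≟_ using (_∈?_)

    unique-⊆-length≥⇒⊇ : ∀ {xs ys : List A} → Unique xs → xs ⊆ ys → length ys ≤ length xs → ys ⊆ xs
    unique-⊆-length≥⇒⊇ {xs} u xs⊆ys ys≤xs {y} y∈ys with y ∈? xs
    ... | yes y∈xs = y∈xs
    ... | no y∉xs with ∈-∃++ y∈ys
    ...   | us , vs , refl =
      contradiction (≤-trans (≤-reflexive (sym (length-++-∷ us vs))) ys≤xs)
                    (≤⇒≯ (unique-⊆⇒length≤ u (⊆-delete xs⊆ys y∉xs)))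

module Permutations where

  open import Data.Nat using (_+_; _<ᵇ_)
  open import Data.Nat.Properties using (<⇒<ᵇ)
  open import Data.List.Membership.DecPropositional Data.Nat._≟_ using (_∈?_)

  addIf : Bool → ℕ → ℕ
  addIf b n = (if b then 1 else 0) + n

  letters : ℕ → List ℕ
  letters n = map suc (upTo n)

  letters-suc-suc : ∀ m → letters (2 + m) ≡ 1 ∷ 2 ∷ map (3 +_) (upTo m)
  letters-suc-suc m = cong (λ xs → 1 ∷ 2 ∷ xs) (trans (map-applyUpTo _ suc m) (sym (map-upTo (3 +_) m)))

  length-letters : ∀ n → length (letters n) ≡ n
  length-letters n = trans (length-map suc (upTo n)) (length-upTo n)

  ∈-letters⇒positive : ∀ {n a} → a ∈ letters n → 0 < a
  ∈-letters⇒positive a∈ with ∈-map⁻ suc a∈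
  ... | _ , _ , refl = s≤s z≤n

  Word : ℕ → ℕ → List ℕ → Set
  Word n k σ = length σ ≡ k × All (_∈ letters n) σ

  words-Word : ∀ n k → All (Word n k) (words n k)
  words-Word n zero    = (refl , []) ∷ []
  words-Word n (suc k) = concat⁺ (map⁺ (All.map extend (words-Word n k)))
    where
    extend : ∀ {w} → Word n k w → All (Word n (suc k)) (map (_∷ w) (letters n))
    extend (len , w⊆) = map⁺ (All.tabulate (λ a∈ → cong suc len , a∈ ∷ w⊆))

  Word⇒positive : ∀ {n k σ} → Word n k σ → All (0 <_) σ
  Word⇒positive (_ , σ⊆) = All.map ∈-letters⇒positive σ⊆

  unique-Word⇒letters⊆ : ∀ {n σ} → Word n n σ → Unique σ → letters n ⊆ σ
  unique-Word⇒letters⊆ {n} (len , σ⊆) u =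
    unique-⊆-length≥⇒⊇ Data.Nat._≟_ u (All.lookup σ⊆) (≤-reflexive (trans (length-letters n) (sym len)))

  above₁ : ∀ {xs} → All (0 <_) xs → All (1 ≢_) xs → All (1 <_) xs
  above₁ pos 1∉ = All.tabulate λ x∈ → above (All.lookup pos x∈) (All.lookup 1∉ x∈)
    where
    above : ∀ {x} → 0 < x → 1 ≢ x → 1 < x
    above {1}           _ 1≢1 = contradiction refl 1≢1
    above {suc (suc _)} _ _   = s≤s (s≤s z≤n)

  above₂ : ∀ {xs} → All (0 <_) xs → All (1 ≢_) xs → All (2 ≢_) xs → All (2 <_) xs
  above₂ pos 1∉ 2∉ = All.tabulate λ x∈ → above (All.lookup pos x∈) (All.lookup 1∉ x∈) (All.lookup 2∉ x∈)
    where
    above : ∀ {x} → 0 < x → 1 ≢ x → 2 ≢ x → 2 < x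
    above {1}                 _ 1≢1 _   = contradiction refl 1≢1
    above {2}                 _ _   2≢2 = contradiction refl 2≢2
    above {suc (suc (suc _))} _ _   _   = s≤s (s≤s (s≤s z≤n))

  <⇒<ᵇ≡true : ∀ {x y} → x < y → (x <ᵇ y) ≡ true
  <⇒<ᵇ≡true x<y = Equivalence.to T-≡ (<⇒<ᵇ x<y)

  swap₁₂ : ℕ → ℕ
  swap₁₂ 1 = 2
  swap₁₂ 2 = 1
  swap₁₂ x = x

  swap₁₂-involutive : ∀ x → swap₁₂ (swap₁₂ x) ≡ x
  swap₁₂-involutive 0                   = refl
  swap₁₂-involutive 1                   = refl
  swap₁₂-involutive 2                   = refl
  swap₁₂-involutive (suc (suc (suc _))) = refl

  swap₁₂-injective : ∀ {x y} → swap₁₂ x ≡ swap₁₂ y → x ≡ y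
  swap₁₂-injective {x} {y} eq =
    trans (sym (swap₁₂-involutive x)) (trans (cong swap₁₂ eq) (swap₁₂-involutive y))

  swap₁₂-positive : ∀ {x} → 0 < x → 0 < swap₁₂ x
  swap₁₂-positive {1}                 _ = s≤s z≤n
  swap₁₂-positive {2}                 _ = s≤s z≤n
  swap₁₂-positive {suc (suc (suc _))} _ = s≤s z≤n

  swap₁₂-large : ∀ {x} → 2 < x → swap₁₂ x ≡ x
  swap₁₂-large (s≤s (s≤s (s≤s _))) = refl

  map-swap₁₂-large : ∀ {xs} → All (2 <_) xs → map swap₁₂ xs ≡ xs
  map-swap₁₂-large []       = refl
  map-swap₁₂-large (p ∷ ps) = cong₂ _∷_ (swap₁₂-large p) (map-swap₁₂-large ps)

  swap₁₂-<ᵇ-large : ∀ x k → (swap₁₂ x <ᵇ 3 + k) ≡ (x <ᵇ 3 + k)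
  swap₁₂-<ᵇ-large 0                   k = refl
  swap₁₂-<ᵇ-large 1                   k = refl
  swap₁₂-<ᵇ-large 2                   k = refl
  swap₁₂-<ᵇ-large (suc (suc (suc _))) k = refl

  large-<ᵇ-swap₁₂ : ∀ k x → (3 + k <ᵇ swap₁₂ x) ≡ (3 + k <ᵇ x)
  large-<ᵇ-swap₁₂ k 0                   = refl
  large-<ᵇ-swap₁₂ k 1                   = refl
  large-<ᵇ-swap₁₂ k 2                   = refl
  large-<ᵇ-swap₁₂ k (suc (suc (suc _))) = refl

  isPeak : ℕ → ℕ → ℕ → Bool
  isPeak a b c = (a <ᵇ b) ∧ (c <ᵇ b)

  isPeak-at-1 : ∀ {a} c → 0 < a → isPeak a 1 c ≡ false
  isPeak-at-1 {suc _} c _ = refl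

  isPeak-at-2 : ∀ {a c} → 0 < a → 0 < c → a ≢ c → isPeak a 2 c ≡ false
  isPeak-at-2 {1}           {1}           _ _ 1≢1 = contradiction refl 1≢1
  isPeak-at-2 {1}           {suc (suc _)} _ _ _   = refl
  isPeak-at-2 {suc (suc _)}               _ _ _   = refl

  isPeak-swap₁₂ : ∀ {a c} b → 0 < a → 0 < c → a ≢ c →
                  isPeak (swap₁₂ a) (swap₁₂ b) (swap₁₂ c) ≡ isPeak a b c
  isPeak-swap₁₂ 0 _ _ _ = refl
  isPeak-swap₁₂ {a} {c} 1 0<a 0<c a≢c =
    trans (isPeak-at-2 (swap₁₂-positive 0<a) (swap₁₂-positive 0<c) (a≢c ∘ swap₁₂-injective))
          (sym (isPeak-at-1 c 0<a))
  isPeak-swap₁₂ {a} {c} 2 0<a 0<c a≢c =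
    trans (isPeak-at-1 (swap₁₂ c) (swap₁₂-positive 0<a)) (sym (isPeak-at-2 0<a 0<c a≢c))
  isPeak-swap₁₂ {a} {c} (suc (suc (suc k))) _ _ _ =
    cong₂ _∧_ (swap₁₂-<ᵇ-large a k) (swap₁₂-<ᵇ-large c k)

  isPair₁₂ : ℕ → ℕ → Bool
  isPair₁₂ 1 2 = true
  isPair₁₂ 2 1 = true
  isPair₁₂ _ _ = false

  startsWith₁₂ : List ℕ → Bool
  startsWith₁₂ (a ∷ b ∷ _) = isPair₁₂ a b
  startsWith₁₂ _           = false

  isPair₁₂-swap₁₂ : ∀ a b → isPair₁₂ (swap₁₂ a) (swap₁₂ b) ≡ isPair₁₂ a b
  isPair₁₂-swap₁₂ 0                   _                   = refl
  isPair₁₂-swap₁₂ 1                   0                   = refl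
  isPair₁₂-swap₁₂ 1                   1                   = refl
  isPair₁₂-swap₁₂ 1                   2                   = refl
  isPair₁₂-swap₁₂ 1                   (suc (suc (suc _))) = refl
  isPair₁₂-swap₁₂ 2                   0                   = refl
  isPair₁₂-swap₁₂ 2                   1                   = refl
  isPair₁₂-swap₁₂ 2                   2                   = refl
  isPair₁₂-swap₁₂ 2                   (suc (suc (suc _))) = refl
  isPair₁₂-swap₁₂ (suc (suc (suc _))) _                   = refl

  startsWith₁₂-swap₁₂ : ∀ σ → startsWith₁₂ (map swap₁₂ σ) ≡ startsWith₁₂ σ
  startsWith₁₂-swap₁₂ []          = refl
  startsWith₁₂-swap₁₂ (_ ∷ [])    = refl
  startsWith₁₂-swap₁₂ (a ∷ b ∷ _) = isPair₁₂-swap₁₂ a b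

  -- With σ₀ = 0, the prefix 2 1 starts with a left peak and 1 2 does not; no other prefix is affected.
  isPeak-initial-swap₁₂ : ∀ b c → isPair₁₂ b c ≡ false → isPeak 0 (swap₁₂ b) (swap₁₂ c) ≡ isPeak 0 b c
  isPeak-initial-swap₁₂ 0                   _                   _  = refl
  isPeak-initial-swap₁₂ 1                   0                   _  = refl
  isPeak-initial-swap₁₂ 1                   1                   _  = refl
  isPeak-initial-swap₁₂ 1                   (suc (suc (suc _))) _  = refl
  isPeak-initial-swap₁₂ 2                   0                   _  = refl
  isPeak-initial-swap₁₂ 2                   2                   _  = refl
  isPeak-initial-swap₁₂ 2                   (suc (suc (suc _))) _  = refl
  isPeak-initial-swap₁₂ (suc (suc (suc k))) c                   _  = swap₁₂-<ᵇ-large c k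

  peaks-swap₁₂ : ∀ a σ → 0 < a → All (0 <_) σ → Unique (a ∷ σ) →
                 peaks (swap₁₂ a ∷ map swap₁₂ σ) ≡ peaks (a ∷ σ)
  peaks-swap₁₂ a []          _   _                 _ = refl
  peaks-swap₁₂ a (_ ∷ [])    _   _                 _ = refl
  peaks-swap₁₂ a (b ∷ c ∷ σ) 0<a (0<b ∷ 0<c ∷ pos) ((_ ∷ a≢c ∷ _) ∷ u) =
    cong₂ addIf (isPeak-swap₁₂ b 0<a 0<c a≢c) (peaks-swap₁₂ b (c ∷ σ) 0<b (0<c ∷ pos) u)

  L-swap₁₂ : ∀ σ → All (0 <_) σ → Unique σ → startsWith₁₂ σ ≡ false → L (map swap₁₂ σ) ≡ L σ
  L-swap₁₂ []          _           _ _      = refl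
  L-swap₁₂ (_ ∷ [])    _           _ _      = refl
  L-swap₁₂ (b ∷ c ∷ σ) (0<b ∷ pos) u ¬start =
    cong₂ addIf (isPeak-initial-swap₁₂ b c ¬start) (peaks-swap₁₂ b (c ∷ σ) 0<b pos u)

  allGreater-true : ∀ {x ys} → All (x <_) ys → allGreater x ys ≡ true
  allGreater-true []         = refl
  allGreater-true (x<y ∷ ps) = cong₂ _∧_ (<⇒<ᵇ≡true x<y) (allGreater-true ps)

  allGreater-false : ∀ {x y ys} → y ∈ ys → (x <ᵇ y) ≡ false → allGreater x ys ≡ false
  allGreater-false {x} {ys = _ ∷ zs} (here refl) x≮y = cong (_∧ allGreater x zs) x≮y
  allGreater-false {x} {ys = z ∷ zs} (there y∈) x≮y =
    trans (cong ((x <ᵇ z) ∧_) (allGreater-false y∈ x≮y)) (∧-zeroʳ (x <ᵇ z))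

  allGreater-swap₁₂-large : ∀ k ys → allGreater (3 + k) (map swap₁₂ ys) ≡ allGreater (3 + k) ys
  allGreater-swap₁₂-large k []       = refl
  allGreater-swap₁₂-large k (y ∷ ys) = cong₂ _∧_ (large-<ᵇ-swap₁₂ k y) (allGreater-swap₁₂-large k ys)

  RLmin-cons-min : ∀ {x ys} → All (x <_) ys → RLmin (x ∷ ys) ≡ suc (RLmin ys)
  RLmin-cons-min {x} {ys} x<ys = cong (λ β → addIf β (RLmin ys)) (allGreater-true x<ys)

  RLmin-swap₁₂-without-1 : ∀ xs → All (0 <_) xs → Unique xs → All (1 ≢_) xs →
                           RLmin (map swap₁₂ xs) ≡ RLmin xs
  RLmin-swap₁₂-without-1 []                    _         _          _          = refl
  RLmin-swap₁₂-without-1 (0 ∷ _)               (() ∷ _)  _          _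
  RLmin-swap₁₂-without-1 (1 ∷ _)               _         _          (1≢1 ∷ _)  = contradiction refl 1≢1
  RLmin-swap₁₂-without-1 (2 ∷ ys)              (_ ∷ pos) (2∉ ∷ _)   (_ ∷ 1∉)   =
    trans (cong (RLmin ∘ (1 ∷_)) (map-swap₁₂-large ys>2))
          (trans (RLmin-cons-min (All.map <⇒≤ ys>2)) (sym (RLmin-cons-min ys>2)))
    where ys>2 = above₂ pos 1∉ 2∉
  RLmin-swap₁₂-without-1 (suc (suc (suc k)) ∷ ys) (_ ∷ pos) (_ ∷ u)   (_ ∷ 1∉)   =
    cong₂ addIf (allGreater-swap₁₂-large k ys) (RLmin-swap₁₂-without-1 ys pos u 1∉)

  oneBeforeTwo : List ℕ → Bool
  oneBeforeTwo []       = false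
  oneBeforeTwo (1 ∷ xs) = does (2 ∈? xs)
  oneBeforeTwo (2 ∷ xs) = false
  oneBeforeTwo (_ ∷ xs) = oneBeforeTwo xs

  oneBeforeTwo-swap₁₂ : ∀ σ → 1 ∈ σ → 2 ∈ σ → oneBeforeTwo (map swap₁₂ σ) ≡ not (oneBeforeTwo σ)
  oneBeforeTwo-swap₁₂ (0 ∷ σ)                 (there 1∈) (there 2∈) = oneBeforeTwo-swap₁₂ σ 1∈ 2∈
  oneBeforeTwo-swap₁₂ (1 ∷ σ)                 _          (there 2∈) = cong not (sym (dec-true (2 ∈? σ) 2∈))
  oneBeforeTwo-swap₁₂ (2 ∷ σ)                 (there 1∈) _          = dec-true (2 ∈? map swap₁₂ σ) (∈-map⁺ swap₁₂ 1∈)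
  oneBeforeTwo-swap₁₂ (suc (suc (suc _)) ∷ σ) (there 1∈) (there 2∈) = oneBeforeTwo-swap₁₂ σ 1∈ 2∈

  RLmin-swap₁₂ : ∀ σ → All (0 <_) σ → Unique σ → oneBeforeTwo σ ≡ true →
                 RLmin σ ≡ suc (RLmin (map swap₁₂ σ))
  RLmin-swap₁₂ (1 ∷ xs) (_ ∷ pos) (1∉ ∷ u) 2∈? = begin
    RLmin (1 ∷ xs)                   ≡⟨ RLmin-cons-min (above₁ pos 1∉) ⟩
    suc (RLmin xs)                   ≡⟨ cong suc (RLmin-swap₁₂-without-1 xs pos u 1∉) ⟨
    suc (RLmin (map swap₁₂ xs))      ≡⟨ cong (λ β → suc (addIf β (RLmin (map swap₁₂ xs)))) 2≮ ⟨
    suc (RLmin (2 ∷ map swap₁₂ xs))  ∎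
    where
    open ≡-Reasoning
    2≮ : allGreater 2 (map swap₁₂ xs) ≡ false
    2≮ = allGreater-false (∈-map⁺ swap₁₂ (does≡true⇒ (2 ∈? xs) 2∈?)) refl
  RLmin-swap₁₂ (suc (suc (suc k)) ∷ xs) (_ ∷ pos) (_ ∷ u) 1≺2 =
    trans (cong₂ addIf (sym (allGreater-swap₁₂-large k xs)) (RLmin-swap₁₂ xs pos u 1≺2))
          (+-suc _ _)

  L-12 : ∀ {τ} → All (2 <_) τ → L (1 ∷ 2 ∷ τ) ≡ L τ
  L-12 []                                 = refl
  L-12 {_ ∷ []}    (s≤s (s≤s (s≤s _)) ∷ _) = refl
  L-12 {_ ∷ _ ∷ _} (s≤s (s≤s (s≤s _)) ∷ _) = refl

  L-21 : ∀ {τ} → All (2 <_) τ → L (2 ∷ 1 ∷ τ) ≡ suc (L τ)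
  L-21 []                                 = refl
  L-21 {_ ∷ []}    (s≤s (s≤s (s≤s _)) ∷ _) = refl
  L-21 {_ ∷ _ ∷ _} (s≤s (s≤s (s≤s _)) ∷ _) = refl

  RLmin-12 : ∀ {τ} → All (2 <_) τ → RLmin (1 ∷ 2 ∷ τ) ≡ 2 + RLmin τ
  RLmin-12 {τ} τ>2 =
    trans (RLmin-cons-min {1} {2 ∷ τ} (s≤s (s≤s z≤n) ∷ All.map <⇒≤ τ>2))
          (cong suc (RLmin-cons-min τ>2))

  RLmin-21 : ∀ {τ} → All (2 <_) τ → RLmin (2 ∷ 1 ∷ τ) ≡ suc (RLmin τ)
  RLmin-21 {τ} τ>2 = RLmin-cons-min {1} {τ} (All.map <⇒≤ τ>2)

  Preserves-<ᵇ : (ℕ → ℕ) → Set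
  Preserves-<ᵇ f = ∀ x y → (f x <ᵇ f y) ≡ (x <ᵇ y)

  peaks-map : ∀ {f} → Preserves-<ᵇ f → ∀ xs → peaks (map f xs) ≡ peaks xs
  peaks-map f-mono (a ∷ b ∷ c ∷ xs) =
    cong₂ addIf (cong₂ _∧_ (f-mono a b) (f-mono c b)) (peaks-map f-mono (b ∷ c ∷ xs))
  peaks-map f-mono []           = refl
  peaks-map f-mono (_ ∷ [])     = refl
  peaks-map f-mono (_ ∷ _ ∷ []) = refl

  allGreater-map : ∀ {f} → Preserves-<ᵇ f → ∀ x ys → allGreater (f x) (map f ys) ≡ allGreater x ys
  allGreater-map f-mono x []       = refl
  allGreater-map f-mono x (y ∷ ys) = cong₂ _∧_ (f-mono x y) (allGreater-map f-mono x ys)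

  RLmin-map : ∀ {f} → Preserves-<ᵇ f → ∀ xs → RLmin (map f xs) ≡ RLmin xs
  RLmin-map f-mono []       = refl
  RLmin-map f-mono (x ∷ xs) = cong₂ addIf (allGreater-map f-mono x xs) (RLmin-map f-mono xs)

  +-preserves-<ᵇ : ∀ k → Preserves-<ᵇ (k +_)
  +-preserves-<ᵇ zero    x y = refl
  +-preserves-<ᵇ (suc k) x y = +-preserves-<ᵇ k x y

  -- σ₀ = 0 is not shifted, but the first peak test is unaffected.
  L-shift₂ : ∀ τ → L (map (2 +_) τ) ≡ L τ
  L-shift₂ []          = refl
  L-shift₂ (_ ∷ [])    = refl
  L-shift₂ (b ∷ c ∷ τ) = cong₂ addIf (initial b) (peaks-map (+-preserves-<ᵇ 2) (b ∷ c ∷ τ))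
    where
    initial : ∀ b → isPeak 0 (2 + b) (2 + c) ≡ isPeak 0 b c
    initial zero    = refl
    initial (suc b) = refl

open Permutations

module Sum {c ℓ} (M : CommutativeMonoid c ℓ) where

  open CommutativeMonoid M renaming (refl to ≈-refl; sym to ≈-sym; trans to ≈-trans)
  open import Relation.Binary.Reasoning.Setoid setoid
  open import Algebra.Properties.CommutativeSemigroup commutativeSemigroup using (x∙yz≈y∙xz)
  open import Data.Nat using (_+_)

  ∑ : {A : Set} → (A → Carrier) → List A → Carrier
  ∑ f = foldr (λ x s → f x ∙ s) ε

  module _ {A : Set} where

    ∑-cong-All : ∀ {f g : A → Carrier} {xs} → All (λ x → f x ≈ g x) xs → ∑ f xs ≈ ∑ g xs
    ∑-cong-All []       = ≈-refl
    ∑-cong-All (p ∷ ps) = ∙-cong p (∑-cong-All ps)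

    ∑-cong : ∀ {f g : A → Carrier} → (∀ x → f x ≈ g x) → ∀ xs → ∑ f xs ≈ ∑ g xs
    ∑-cong f≈g xs = ∑-cong-All (All.universal f≈g xs)

    ∑-zero : ∀ {f : A → Carrier} {xs} → All (λ x → f x ≈ ε) xs → ∑ f xs ≈ ε
    ∑-zero []       = ≈-refl
    ∑-zero (p ∷ ps) = ≈-trans (∙-cong p (∑-zero ps)) (identityˡ ε)

    ∑-map : ∀ {B : Set} (f : B → Carrier) (g : A → B) xs → ∑ f (map g xs) ≡ ∑ (f ∘ g) xs
    ∑-map f g []       = refl
    ∑-map f g (x ∷ xs) = cong (f (g x) ∙_) (∑-map f g xs)

    ∑-++ : ∀ (f : A → Carrier) xs ys → ∑ f (xs ++ ys) ≈ ∑ f xs ∙ ∑ f ys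
    ∑-++ f []       ys = ≈-sym (identityˡ _)
    ∑-++ f (x ∷ xs) ys = ≈-trans (∙-congˡ (∑-++ f xs ys)) (≈-sym (assoc _ _ _))

    ∑-concat : ∀ (f : A → Carrier) xss → ∑ f (concat xss) ≈ ∑ (∑ f) xss
    ∑-concat f []         = ≈-refl
    ∑-concat f (xs ∷ xss) = ≈-trans (∑-++ f xs (concat xss)) (∙-congˡ (∑-concat f xss))

    ∑-∙ : ∀ (f g : A → Carrier) xs → ∑ (λ x → f x ∙ g x) xs ≈ ∑ f xs ∙ ∑ g xs
    ∑-∙ f g []       = ≈-sym (identityˡ ε)
    ∑-∙ f g (x ∷ xs) = begin
      (f x ∙ g x) ∙ ∑ (λ x → f x ∙ g x) xs ≈⟨ ∙-congˡ (∑-∙ f g xs) ⟩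
      (f x ∙ g x) ∙ (∑ f xs ∙ ∑ g xs)     ≈⟨ assoc _ _ _ ⟩
      f x ∙ (g x ∙ (∑ f xs ∙ ∑ g xs))     ≈⟨ ∙-congˡ (x∙yz≈y∙xz _ _ _) ⟩
      f x ∙ (∑ f xs ∙ (g x ∙ ∑ g xs))     ≈⟨ assoc _ _ _ ⟨
      (f x ∙ ∑ f xs) ∙ (g x ∙ ∑ g xs)     ∎

    ∑-filter : ∀ {P : A → Set} (P? : Decidable P) (f : A → Carrier) xs →
               ∑ f (filter P? xs) ≈ ∑ (λ x → if does (P? x) then f x else ε) xs
    ∑-filter P? f []       = ≈-refl
    ∑-filter P? f (x ∷ xs) with does (P? x)
    ... | true  = ∙-congˡ (∑-filter P? f xs)
    ... | false = ≈-trans (∑-filter P? f xs) (≈-sym (identityˡ _))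

    ∑-if-∧ʳ : ∀ (p : A → Bool) b (f : A → Carrier) xs →
              ∑ (λ x → if p x ∧ b then f x else ε) xs
              ≈ (if b then ∑ (λ x → if p x then f x else ε) xs else ε)
    ∑-if-∧ʳ p true  f xs =
      ∑-cong (λ x → reflexive (cong (if_then f x else ε) (∧-identityʳ (p x)))) xs
    ∑-if-∧ʳ p false f xs =
      ∑-zero (All.universal (λ x → reflexive (cong (if_then f x else ε) (∧-zeroʳ (p x)))) xs)

  if-congᵗ : ∀ b {x y z} → x ≈ y → (if b then x else z) ≈ (if b then y else z)
  if-congᵗ true  x≈y = x≈y
  if-congᵗ false _   = ≈-refl

  partition₃ : ∀ p q x →
               x ≈ (if p ∧ not q then x else ε) ∙ ((if not p ∧ not q then x else ε) ∙ (if q then x else ε))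
  partition₃ true  true  x = ≈-sym (≈-trans (identityˡ _) (identityˡ x))
  partition₃ true  false x = ≈-sym (≈-trans (∙-congˡ (identityˡ ε)) (identityʳ x))
  partition₃ false true  x = ≈-sym (≈-trans (identityˡ _) (identityˡ x))
  partition₃ false false x = ≈-sym (≈-trans (identityˡ _) (identityʳ x))

  ∑-words-suc : ∀ (g : List ℕ → Carrier) n k →
                ∑ g (words n (suc k)) ≈ ∑ (λ w → ∑ (λ a → g (a ∷ w)) (letters n)) (words n k)
  ∑-words-suc g n k = begin
    ∑ g (concat (map extend (words n k)))                ≈⟨ ∑-concat g (map extend (words n k)) ⟩
    ∑ (∑ g) (map extend (words n k))                     ≡⟨ ∑-map (∑ g) extend (words n k) ⟩
    ∑ (λ w → ∑ g (extend w)) (words n k)                 ≈⟨ ∑-cong (λ w → reflexive (∑-map g (_∷ w) (letters n))) (words n k) ⟩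
    ∑ (λ w → ∑ (λ a → g (a ∷ w)) (letters n)) (words n k) ∎
    where
    extend : List ℕ → List (List ℕ)
    extend w = map (_∷ w) (letters n)

  ∑-words-transfer : ∀ {P : ℕ → Set} (P? : Decidable P) (f : ℕ → ℕ) {n m} →
    (∀ h → ∑ (λ a → if does (P? a) then h a else ε) (letters n) ≈ ∑ (h ∘ f) (letters m)) →
    ∀ k g → ∑ (λ w → if does (all? P? w) then g w else ε) (words n k) ≈ ∑ (g ∘ map f) (words m k)
  ∑-words-transfer P? f             hyp zero    g = ≈-refl
  ∑-words-transfer P? f {n} {m} hyp (suc k) g = begin
    ∑ (λ w → if does (all? P? w) then g w else ε) (words n (suc k))
      ≈⟨ ∑-words-suc (λ w → if does (all? P? w) then g w else ε) n k ⟩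
    ∑ (λ w → ∑ (λ a → if does (P? a) ∧ does (all? P? w) then g (a ∷ w) else ε) (letters n)) (words n k)
      ≈⟨ ∑-cong (λ w → ∑-if-∧ʳ (does ∘ P?) (does (all? P? w)) _ (letters n)) (words n k) ⟩
    ∑ (λ w → if does (all? P? w) then ∑ (λ a → if does (P? a) then g (a ∷ w) else ε) (letters n) else ε) (words n k)
      ≈⟨ ∑-cong (λ w → if-congᵗ (does (all? P? w)) (hyp (λ a → g (a ∷ w)))) (words n k) ⟩
    ∑ (λ w → if does (all? P? w) then ∑ (λ b → g (f b ∷ w)) (letters m) else ε) (words n k)
      ≈⟨ ∑-words-transfer P? f hyp k (λ w → ∑ (λ b → g (f b ∷ w)) (letters m)) ⟩
    ∑ (λ v → ∑ (λ b → g (f b ∷ map f v)) (letters m)) (words m k)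
      ≈⟨ ∑-words-suc (g ∘ map f) m k ⟨
    ∑ (g ∘ map f) (words m (suc k)) ∎

  ∑-letters-swap₁₂ : ∀ m h → ∑ h (letters (2 + m)) ≈ ∑ (h ∘ swap₁₂) (letters (2 + m))
  ∑-letters-swap₁₂ m h = begin
    ∑ h (letters (2 + m))                              ≡⟨ cong (∑ h) (letters-suc-suc m) ⟩
    h 1 ∙ (h 2 ∙ ∑ h (map (3 +_) (upTo m)))
      ≡⟨ cong (λ s → h 1 ∙ (h 2 ∙ s)) (trans (∑-map h (3 +_) (upTo m)) (sym (∑-map (h ∘ swap₁₂) (3 +_) (upTo m)))) ⟩
    h 1 ∙ (h 2 ∙ ∑ (h ∘ swap₁₂) (map (3 +_) (upTo m))) ≈⟨ x∙yz≈y∙xz _ _ _ ⟩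
    h 2 ∙ (h 1 ∙ ∑ (h ∘ swap₁₂) (map (3 +_) (upTo m))) ≡⟨ cong (∑ (h ∘ swap₁₂)) (letters-suc-suc m) ⟨
    ∑ (h ∘ swap₁₂) (letters (2 + m))                   ∎

  ∑-letters-shift₂ : ∀ m h → ∑ (λ a → if does (2 <? a) then h a else ε) (letters (2 + m)) ≈ ∑ (h ∘ (2 +_)) (letters m)
  ∑-letters-shift₂ m h = begin
    ∑ h>2 (letters (2 + m))                 ≡⟨ cong (∑ h>2) (letters-suc-suc m) ⟩
    ε ∙ (ε ∙ ∑ h>2 (map (3 +_) (upTo m)))   ≈⟨ ≈-trans (identityˡ _) (identityˡ _) ⟩
    ∑ h>2 (map (3 +_) (upTo m))             ≡⟨ ∑-map h>2 (3 +_) (upTo m) ⟩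
    ∑ (h ∘ (3 +_)) (upTo m)                 ≡⟨ ∑-map (h ∘ (2 +_)) suc (upTo m) ⟨
    ∑ (h ∘ (2 +_)) (letters m)              ∎
    where
    h>2 : ℕ → Carrier
    h>2 a = if does (2 <? a) then h a else ε

  ∑-letters-pick₁₂ : ∀ m h → (∀ k → h (3 + k) ≈ ε) → ∑ h (letters (2 + m)) ≈ h 1 ∙ h 2
  ∑-letters-pick₁₂ m h h≈ε = begin
    ∑ h (letters (2 + m))                   ≡⟨ cong (∑ h) (letters-suc-suc m) ⟩
    h 1 ∙ (h 2 ∙ ∑ h (map (3 +_) (upTo m))) ≡⟨ cong (λ s → h 1 ∙ (h 2 ∙ s)) (∑-map h (3 +_) (upTo m)) ⟩
    h 1 ∙ (h 2 ∙ ∑ (h ∘ (3 +_)) (upTo m))   ≈⟨ ∙-congˡ (∙-congˡ (∑-zero (All.universal h≈ε (upTo m)))) ⟩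
    h 1 ∙ (h 2 ∙ ε)                         ≈⟨ ∙-congˡ (identityʳ _) ⟩
    h 1 ∙ h 2                               ∎

  ∑-words-swap₁₂ : ∀ m k g → ∑ g (words (2 + m) k) ≈ ∑ (g ∘ map swap₁₂) (words (2 + m) k)
  ∑-words-swap₁₂ m k g = begin
    ∑ g (words (2 + m) k)
      ≈⟨ ∑-cong (λ w → reflexive (cong (if_then g w else ε) (sym (dec-true (all? U? w) (All.universal U-Universal w)))))
                (words (2 + m) k) ⟩
    ∑ (λ w → if does (all? U? w) then g w else ε) (words (2 + m) k)
      ≈⟨ ∑-words-transfer U? swap₁₂ (∑-letters-swap₁₂ m) k g ⟩
    ∑ (g ∘ map swap₁₂) (words (2 + m) k) ∎

  ∑-words-shift₂ : ∀ m k g → ∑ (λ w → if does (all? (2 <?_) w) then g w else ε) (words (2 + m) k)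
                             ≈ ∑ (g ∘ map (2 +_)) (words m k)
  ∑-words-shift₂ m = ∑-words-transfer (2 <?_) (2 +_) (∑-letters-shift₂ m)

  ∑-startsWith₁₂ : ∀ m k (g : List ℕ → Carrier) →
                   ∑ (λ σ → if startsWith₁₂ σ then g σ else ε) (words (2 + m) (2 + k))
                   ≈ ∑ (λ τ → g (1 ∷ 2 ∷ τ) ∙ g (2 ∷ 1 ∷ τ)) (words (2 + m) k)
  ∑-startsWith₁₂ m k g = begin
    ∑ G (words n (2 + k))
      ≈⟨ ∑-words-suc G n (suc k) ⟩
    ∑ (λ w → ∑ (λ a → G (a ∷ w)) (letters n)) (words n (suc k))
      ≈⟨ ∑-words-suc (λ w → ∑ (λ a → G (a ∷ w)) (letters n)) n k ⟩
    ∑ (λ τ → ∑ (λ b → ∑ (λ a → G (a ∷ b ∷ τ)) (letters n)) (letters n)) (words n k)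
      ≈⟨ ∑-cong pick (words n k) ⟩
    ∑ (λ τ → g (1 ∷ 2 ∷ τ) ∙ g (2 ∷ 1 ∷ τ)) (words n k) ∎
    where
    n = 2 + m
    G : List ℕ → Carrier
    G σ = if startsWith₁₂ σ then g σ else ε
    pick : ∀ τ → ∑ (λ b → ∑ (λ a → G (a ∷ b ∷ τ)) (letters n)) (letters n)
                 ≈ g (1 ∷ 2 ∷ τ) ∙ g (2 ∷ 1 ∷ τ)
    pick τ = begin
      ∑ (λ b → ∑ (λ a → G (a ∷ b ∷ τ)) (letters n)) (letters n)
        ≈⟨ ∑-cong (λ b → ∑-letters-pick₁₂ m (λ a → G (a ∷ b ∷ τ)) (λ _ → ≈-refl)) (letters n) ⟩
      ∑ (λ b → G (1 ∷ b ∷ τ) ∙ G (2 ∷ b ∷ τ)) (letters n)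
        ≈⟨ ∑-letters-pick₁₂ m (λ b → G (1 ∷ b ∷ τ) ∙ G (2 ∷ b ∷ τ)) (λ _ → identityˡ ε) ⟩
      (ε ∙ g (2 ∷ 1 ∷ τ)) ∙ (g (1 ∷ 2 ∷ τ) ∙ ε)
        ≈⟨ ∙-cong (identityˡ _) (identityʳ _) ⟩
      g (2 ∷ 1 ∷ τ) ∙ g (1 ∷ 2 ∷ τ)
        ≈⟨ comm _ _ ⟩
      g (1 ∷ 2 ∷ τ) ∙ g (2 ∷ 1 ∷ τ) ∎

module _ {c ℓ} (R : CommutativeRing c ℓ) (u : CommutativeRing.Carrier R) where

  open CommutativeRing R hiding (zero) renaming (refl to ≈-refl; sym to ≈-sym; trans to ≈-trans)
  open RawSemiringDefs (Semiring.rawSemiring semiring) using (_^_)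
  open import Relation.Binary.Reasoning.Setoid setoid
  open import Algebra.Properties.Ring ring using (-1*x≈-x; -‿distribʳ-*; -‿distribˡ-*; -‿involutive)
  open Sum +-commutativeMonoid
  open import Data.Nat using () renaming (_+_ to _+ℕ_)

  ∑-*ˡ : ∀ {A : Set} a (f : A → Carrier) xs → ∑ (λ x → a * f x) xs ≈ a * ∑ f xs
  ∑-*ˡ a f []       = ≈-sym (zeroʳ a)
  ∑-*ˡ a f (x ∷ xs) = ≈-trans (+-congˡ (∑-*ˡ a f xs)) (≈-sym (distribˡ a _ _))

  weight : List ℕ → Carrier
  weight σ = (u ^ L σ) * ((- 1#) ^ RLmin σ)

  uniqueWeight : List ℕ → Carrier
  uniqueWeight σ = if does (unique? σ) then weight σ else 0#

  uniqueWeight-unique : ∀ {σ} → Unique σ → uniqueWeight σ ≡ weight σ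
  uniqueWeight-unique {σ} uσ = cong (if_then weight σ else 0#) (dec-true (unique? σ) uσ)

  uniqueWeight-¬unique : ∀ {σ} → ¬ Unique σ → uniqueWeight σ ≡ 0#
  uniqueWeight-¬unique {σ} ¬uσ = cong (if_then weight σ else 0#) (dec-false (unique? σ) ¬uσ)

  weight-cancel : ∀ {σ σ′} → L σ′ ≡ L σ → RLmin σ ≡ suc (RLmin σ′) → weight σ + weight σ′ ≈ 0#
  weight-cancel {σ} {σ′} L≡ RLmin≡ = begin
    weight σ + weight σ′
      ≡⟨ cong₂ (λ l r → u ^ l * (- 1#) ^ r + weight σ′) (sym L≡) RLmin≡ ⟩
    u ^ L σ′ * ((- 1#) * (- 1#) ^ RLmin σ′) + weight σ′
      ≈⟨ +-congʳ (*-congˡ (-1*x≈-x _)) ⟩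
    u ^ L σ′ * - ((- 1#) ^ RLmin σ′) + weight σ′
      ≈⟨ +-congʳ (-‿distribʳ-* _ _) ⟨
    - weight σ′ + weight σ′
      ≈⟨ -‿inverseˡ _ ⟩
    0# ∎

  weight-12 : ∀ {τ} → All (2 <_) τ → weight (1 ∷ 2 ∷ τ) ≈ weight τ
  weight-12 {τ} τ>2 = begin
    weight (1 ∷ 2 ∷ τ)
      ≡⟨ cong₂ (λ l r → u ^ l * (- 1#) ^ r) (L-12 τ>2) (RLmin-12 τ>2) ⟩
    u ^ L τ * ((- 1#) * ((- 1#) * (- 1#) ^ RLmin τ))
      ≈⟨ *-congˡ (≈-trans (-1*x≈-x _) (-‿cong (-1*x≈-x _))) ⟩
    u ^ L τ * - - ((- 1#) ^ RLmin τ)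
      ≈⟨ *-congˡ (-‿involutive _) ⟩
    weight τ ∎

  weight-21 : ∀ {τ} → All (2 <_) τ → weight (2 ∷ 1 ∷ τ) ≈ - u * weight τ
  weight-21 {τ} τ>2 = begin
    weight (2 ∷ 1 ∷ τ)
      ≡⟨ cong₂ (λ l r → u ^ l * (- 1#) ^ r) (L-21 τ>2) (RLmin-21 τ>2) ⟩
    (u * u ^ L τ) * ((- 1#) * (- 1#) ^ RLmin τ)
      ≈⟨ *-congˡ (-1*x≈-x _) ⟩
    (u * u ^ L τ) * - ((- 1#) ^ RLmin τ)
      ≈⟨ -‿distribʳ-* _ _ ⟨
    - ((u * u ^ L τ) * (- 1#) ^ RLmin τ)
      ≈⟨ -‿cong (*-assoc _ _ _) ⟩
    - (u * weight τ)
      ≈⟨ -‿distribˡ-* u (weight τ) ⟩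
    - u * weight τ ∎

  uniqueWeightAbove₂ : List ℕ → Carrier
  uniqueWeightAbove₂ τ = if does (all? (2 <?_) τ) then uniqueWeight τ else 0#

  uniqueWeight-prefix : ∀ {a b τ} c →
    (Unique (a ∷ b ∷ τ) → All (2 <_) τ) → (All (2 <_) τ → Unique τ → Unique (a ∷ b ∷ τ)) →
    (All (2 <_) τ → weight (a ∷ b ∷ τ) ≈ c * weight τ) →
    uniqueWeight (a ∷ b ∷ τ) ≈ c * uniqueWeightAbove₂ τ
  uniqueWeight-prefix {a} {b} {τ} c unique⇒τ>2 τ>2⇒unique weight≈ = cases (all? (2 <?_) τ) (unique? τ)
    where
    above₂-yes : All (2 <_) τ → uniqueWeightAbove₂ τ ≡ uniqueWeight τ
    above₂-yes τ>2 = cong (if_then uniqueWeight τ else 0#) (dec-true (all? (2 <?_) τ) τ>2)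

    above₂-no : ¬ All (2 <_) τ → uniqueWeightAbove₂ τ ≡ 0#
    above₂-no ¬τ>2 = cong (if_then uniqueWeight τ else 0#) (dec-false (all? (2 <?_) τ) ¬τ>2)

    cases : Dec (All (2 <_) τ) → Dec (Unique τ) → uniqueWeight (a ∷ b ∷ τ) ≈ c * uniqueWeightAbove₂ τ
    cases (no ¬τ>2) _ = begin
      uniqueWeight (a ∷ b ∷ τ) ≡⟨ uniqueWeight-¬unique {a ∷ b ∷ τ} (¬τ>2 ∘ unique⇒τ>2) ⟩
      0#                       ≈⟨ zeroʳ c ⟨
      c * 0#                   ≡⟨ cong (c *_) (above₂-no ¬τ>2) ⟨
      c * uniqueWeightAbove₂ τ ∎
    cases (yes τ>2) (no ¬uτ) = begin
      uniqueWeight (a ∷ b ∷ τ) ≡⟨ uniqueWeight-¬unique {a ∷ b ∷ τ} (λ { (_ ∷ _ ∷ uτ) → ¬uτ uτ }) ⟩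
      0#                       ≈⟨ zeroʳ c ⟨
      c * 0#                   ≡⟨ cong (c *_) (trans (above₂-yes τ>2) (uniqueWeight-¬unique {τ} ¬uτ)) ⟨
      c * uniqueWeightAbove₂ τ ∎
    cases (yes τ>2) (yes uτ) = begin
      uniqueWeight (a ∷ b ∷ τ) ≡⟨ uniqueWeight-unique {a ∷ b ∷ τ} (τ>2⇒unique τ>2 uτ) ⟩
      weight (a ∷ b ∷ τ)       ≈⟨ weight≈ τ>2 ⟩
      c * weight τ             ≡⟨ cong (c *_) (trans (above₂-yes τ>2) (uniqueWeight-unique {τ} uτ)) ⟨
      c * uniqueWeightAbove₂ τ ∎

  uniqueWeight-initialPair : ∀ {τ} → All (0 <_) τ →
    uniqueWeight (1 ∷ 2 ∷ τ) + uniqueWeight (2 ∷ 1 ∷ τ) ≈ (1# - u) * uniqueWeightAbove₂ τ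
  uniqueWeight-initialPair {τ} pos = begin
    uniqueWeight (1 ∷ 2 ∷ τ) + uniqueWeight (2 ∷ 1 ∷ τ)
      ≈⟨ +-cong (uniqueWeight-prefix 1#  (λ { ((_ ∷ 1∉) ∷ 2∉ ∷ _) → above₂ pos 1∉ 2∉ })
                                         (λ τ>2 uτ → ((λ ()) ∷ All.map 1≢ τ>2) ∷ All.map 2≢ τ>2 ∷ uτ)
                                         (λ τ>2 → ≈-trans (weight-12 τ>2) (≈-sym (*-identityˡ _))))
                (uniqueWeight-prefix (- u) (λ { ((_ ∷ 2∉) ∷ 1∉ ∷ _) → above₂ pos 1∉ 2∉ })
                                           (λ τ>2 uτ → ((λ ()) ∷ All.map 2≢ τ>2) ∷ All.map 1≢ τ>2 ∷ uτ)
                                           weight-21) ⟩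
    1# * uniqueWeightAbove₂ τ + - u * uniqueWeightAbove₂ τ
      ≈⟨ distribʳ _ 1# (- u) ⟨
    (1# - u) * uniqueWeightAbove₂ τ ∎
    where
    1≢ : ∀ {y} → 2 < y → 1 ≢ y
    1≢ = <⇒≢ ∘ <⇒≤
    2≢ : ∀ {y} → 2 < y → 2 ≢ y
    2≢ = <⇒≢

  uniqueWeight-shift₂ : ∀ τ → uniqueWeight (map (2 +ℕ_) τ) ≡ uniqueWeight τ
  uniqueWeight-shift₂ τ =
    cong₂ (λ b w → if b then w else 0#)
          (does-⇔ (mk⇔ Unique.map⁻ (Unique.map⁺ (suc-injective ∘ suc-injective))) (unique? _) (unique? τ))
          (cong₂ (λ l r → u ^ l * (- 1#) ^ r) (L-shift₂ τ) (RLmin-map (+-preserves-<ᵇ 2) τ))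

  sumLR≈∑uniqueWeight : ∀ n → sumLR R u n ≈ ∑ uniqueWeight (words n n)
  sumLR≈∑uniqueWeight n = ∑-filter unique? weight (words n n)

  oneFirstWeight twoFirstWeight initialPairWeight : List ℕ → Carrier
  oneFirstWeight σ    = if oneBeforeTwo σ ∧ not (startsWith₁₂ σ) then uniqueWeight σ else 0#
  twoFirstWeight σ    = if not (oneBeforeTwo σ) ∧ not (startsWith₁₂ σ) then uniqueWeight σ else 0#
  initialPairWeight σ = if startsWith₁₂ σ then uniqueWeight σ else 0#

  guarded-cancel : ∀ p q {x y} → (p ≡ true → q ≡ false → x + y ≈ 0#) →
                   (if p ∧ not q then x else 0#) + (if p ∧ not q then y else 0#) ≈ 0#
  guarded-cancel true  false x+y≈0 = x+y≈0 refl refl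
  guarded-cancel true  true  _     = +-identityˡ 0#
  guarded-cancel false _     _     = +-identityˡ 0#

  oneFirst+twoFirst∘swap₁₂≈0 : ∀ {m σ} → Word (2 +ℕ m) (2 +ℕ m) σ →
                               oneFirstWeight σ + twoFirstWeight (map swap₁₂ σ) ≈ 0#
  oneFirst+twoFirst∘swap₁₂≈0 {m} {σ} w = cases (unique? σ)
    where
    σ′ = map swap₁₂ σ
    g  = oneBeforeTwo σ ∧ not (startsWith₁₂ σ)
    g′ = not (oneBeforeTwo σ′) ∧ not (startsWith₁₂ σ′)

    cases : Dec (Unique σ) → oneFirstWeight σ + twoFirstWeight σ′ ≈ 0#
    cases (no ¬uσ) = begin
      oneFirstWeight σ + twoFirstWeight σ′
        ≡⟨ cong₂ _+_ (cong (if g then_else 0#) (uniqueWeight-¬unique {σ} ¬uσ))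
                     (cong (if g′ then_else 0#) (uniqueWeight-¬unique {σ′} (¬uσ ∘ Unique.map⁻))) ⟩
      (if g then 0# else 0#) + (if g′ then 0# else 0#)
        ≡⟨ cong₂ _+_ (if-eta g) (if-eta g′) ⟩
      0# + 0#
        ≈⟨ +-identityˡ 0# ⟩
      0# ∎
    cases (yes uσ) = begin
      oneFirstWeight σ + twoFirstWeight σ′
        ≡⟨ cong₂ _+_ (cong (if g then_else 0#) (uniqueWeight-unique {σ} uσ))
                     (cong₂ (if_then_else 0#) g′≡g (uniqueWeight-unique {σ′} (Unique.map⁺ swap₁₂-injective uσ))) ⟩
      (if g then weight σ else 0#) + (if g then weight σ′ else 0#)
        ≈⟨ guarded-cancel (oneBeforeTwo σ) (startsWith₁₂ σ) (λ 1≺2 ¬start →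
             weight-cancel {σ} {σ′} (L-swap₁₂ σ pos uσ ¬start) (RLmin-swap₁₂ σ pos uσ 1≺2)) ⟩
      0# ∎
      where
      pos = Word⇒positive w
      letters⊆σ = unique-Word⇒letters⊆ w uσ
      g′≡g : g′ ≡ g
      g′≡g = trans (cong₂ (λ p q → not p ∧ not q)
                          (oneBeforeTwo-swap₁₂ σ (letters⊆σ (here refl)) (letters⊆σ (there (here refl))))
                          (startsWith₁₂-swap₁₂ σ))
                   (cong (_∧ not (startsWith₁₂ σ)) (not-involutive (oneBeforeTwo σ)))

  ∑-oneFirst+∑-twoFirst≈0 : ∀ m → let W = words (2 +ℕ m) (2 +ℕ m) in
                            ∑ oneFirstWeight W + ∑ twoFirstWeight W ≈ 0#
  ∑-oneFirst+∑-twoFirst≈0 m = begin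
    ∑ oneFirstWeight W + ∑ twoFirstWeight W
      ≈⟨ +-congˡ (∑-words-swap₁₂ m n twoFirstWeight) ⟩
    ∑ oneFirstWeight W + ∑ (twoFirstWeight ∘ map swap₁₂) W
      ≈⟨ ∑-∙ oneFirstWeight (twoFirstWeight ∘ map swap₁₂) W ⟨
    ∑ (λ σ → oneFirstWeight σ + twoFirstWeight (map swap₁₂ σ)) W
      ≈⟨ ∑-zero (All.map oneFirst+twoFirst∘swap₁₂≈0 (words-Word n n)) ⟩
    0# ∎
    where
    n = 2 +ℕ m
    W = words n n

  ∑-initialPairWeight : ∀ m → ∑ initialPairWeight (words (2 +ℕ m) (2 +ℕ m)) ≈ (1# - u) * sumLR R u m
  ∑-initialPairWeight m = begin
    ∑ initialPairWeight (words n n)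
      ≈⟨ ∑-startsWith₁₂ m m uniqueWeight ⟩
    ∑ (λ τ → uniqueWeight (1 ∷ 2 ∷ τ) + uniqueWeight (2 ∷ 1 ∷ τ)) (words n m)
      ≈⟨ ∑-cong-All (All.map (uniqueWeight-initialPair ∘ Word⇒positive) (words-Word n m)) ⟩
    ∑ (λ τ → (1# - u) * uniqueWeightAbove₂ τ) (words n m)
      ≈⟨ ∑-*ˡ (1# - u) uniqueWeightAbove₂ (words n m) ⟩
    (1# - u) * ∑ uniqueWeightAbove₂ (words n m)
      ≈⟨ *-congˡ (∑-words-shift₂ m m uniqueWeight) ⟩
    (1# - u) * ∑ (uniqueWeight ∘ map (2 +ℕ_)) (words m m)
      ≈⟨ *-congˡ (∑-cong (reflexive ∘ uniqueWeight-shift₂) (words m m)) ⟩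
    (1# - u) * ∑ uniqueWeight (words m m)
      ≈⟨ *-congˡ (sumLR≈∑uniqueWeight m) ⟨
    (1# - u) * sumLR R u m ∎
    where n = 2 +ℕ m

  sumLR-suc-suc : ∀ m → sumLR R u (2 +ℕ m) ≈ (1# - u) * sumLR R u m
  sumLR-suc-suc m = begin
    sumLR R u n
      ≈⟨ sumLR≈∑uniqueWeight n ⟩
    ∑ uniqueWeight W
      ≈⟨ ∑-cong (λ σ → partition₃ (oneBeforeTwo σ) (startsWith₁₂ σ) (uniqueWeight σ)) W ⟩
    ∑ (λ σ → oneFirstWeight σ + (twoFirstWeight σ + initialPairWeight σ)) W
      ≈⟨ ≈-trans (∑-∙ oneFirstWeight _ W) (+-congˡ (∑-∙ twoFirstWeight initialPairWeight W)) ⟩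
    ∑ oneFirstWeight W + (∑ twoFirstWeight W + ∑ initialPairWeight W)
      ≈⟨ +-assoc _ _ _ ⟨
    (∑ oneFirstWeight W + ∑ twoFirstWeight W) + ∑ initialPairWeight W
      ≈⟨ +-congʳ (∑-oneFirst+∑-twoFirst≈0 m) ⟩
    0# + ∑ initialPairWeight W
      ≈⟨ +-identityˡ _ ⟩
    ∑ initialPairWeight W
      ≈⟨ ∑-initialPairWeight m ⟩
    (1# - u) * sumLR R u m ∎
    where
    n = 2 +ℕ m
    W = words n n

  sumLR-closedForm : ∀ n → (n % 2 ≡ 0 → sumLR R u n ≈ (1# - u) ^ ⌊ n /2⌋)
                         × (n % 2 ≡ 1 → sumLR R u n ≈ - ((1# - u) ^ ⌊ n /2⌋))
  sumLR-closedForm 0 = (λ _ → ≈-trans (+-identityʳ _) (*-identityˡ 1#)) , (λ ())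
  sumLR-closedForm 1 = (λ ()) , (λ _ → ≈-trans (+-identityʳ _) (≈-trans (*-identityˡ _) (*-identityʳ _)))
  sumLR-closedForm (suc (suc m)) with sumLR-closedForm m
  ... | even , odd =
    (λ n-even → ≈-trans (sumLR-suc-suc m) (*-congˡ (even n-even))) ,
    (λ n-odd  → ≈-trans (sumLR-suc-suc m) (≈-trans (*-congˡ (odd n-odd)) (≈-sym (-‿distribʳ-* _ _))))

open RawSemiringDefs using (_^_)

mainTheorem4 : ∀ {c ℓ : Level} (R : CommutativeRing c ℓ) (u : CommutativeRing.Carrier R) (n : ℕ) → n ≥ 1 →
    let open CommutativeRing R in
    (n % 2 ≡ 0 → sumLR R u n ≈ _^_ (Semiring.rawSemiring semiring) (1# - u) ⌊ n /2⌋)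
    × (n % 2 ≡ 1 → sumLR R u n ≈ - (_^_ (Semiring.rawSemiring semiring) (1# - u) ⌊ n /2⌋))
mainTheorem4 R u n _ = sumLR-closedForm R u n
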